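{- Let $n\ge3$, let $a=(a_1,\ldots,a_{n-1})\in\{1,-1\}^{n-1}$ and let $p_a$ be its associated partial order on $\{1,\ldots,n\}$. Suppose there exists $i$ with $2\le i\le n-1$ and $a_i=a_{i-1}$, and let $i$ be the largest such index. Then $|L(p_a)|<|L(p_{a\Phi_i})|$.
   Context: For $a\in\{1,-1\}^{n-1}$, $p_a$ is the partial order on $\{1,\ldots,n\}$ which is the transitive closure of the relations $j<j+1$ for each $j$ with $a_j=1$ and $j+1<j$ for each $j$ with $a_j=-1$ (its Hasse diagram is the path $1-2-\cdots-n$). $L(p)$ is the set of linear extensions of $p$. Right-side inversion at $i$ is $(a_1,\ldots,a_{n-1})\Phi_i=(a_1,\ldots,a_{i-1},-a_i,-a_{i+1},\ldots,-a_{n-1})$. -}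

module Defs where

open import Data.Nat using (ℕ; zero; suc; _∸_; _≤_; _≤ᵇ_)
open import Data.Bool using (if_then_else_)
open import Data.Fin using (Fin; toℕ) renaming (_<_ to _<ᶠ_)
open import Data.Vec using (Vec; []; _∷_; lookup; tabulate)
open import Relation.Binary.PropositionalEquality using (_≡_)
open import Relation.Binary.Construct.Closure.Transitive using (TransClosure)

data Sign : Set where
  plus minus : Sign

neg : Sign → Sign
neg plus  = minus
neg minus = plus

-- 1-based access: a ! j = a_j for 1 ≤ j ≤ length; junk value (plus) otherwise.
-- Only used under explicit range hypotheses.
_!_ : ∀ {m} → Vec Sign m → ℕ → Sign
[]      ! _           = plus
(x ∷ a) ! zero        = plus
(x ∷ a) ! suc zero    = x
(x ∷ a) ! suc (suc j) = a ! suc j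

-- Right-side inversion at i (1-based): negate a_j for all j ≥ i.
Φ : ∀ {m} → Vec Sign m → ℕ → Vec Sign m
Φ {m} a i = tabulate (λ k → if i ≤ᵇ suc (toℕ k) then neg (lookup a k) else lookup a k)

-- Covering relations of p_a on {1,…,n}; the element x : Fin n stands for toℕ x + 1.
-- a_j = 1 gives j < j+1, a_j = -1 gives j+1 < j.
data Cover (n : ℕ) (a : Vec Sign (n ∸ 1)) : Fin n → Fin n → Set where
  up   : ∀ {x y} (j : ℕ) → 1 ≤ j → j ≤ n ∸ 1 → a ! j ≡ plus →
         suc (toℕ x) ≡ j → suc (toℕ y) ≡ suc j → Cover n a x y
  down : ∀ {x y} (j : ℕ) → 1 ≤ j → j ≤ n ∸ 1 → a ! j ≡ minus →
         suc (toℕ x) ≡ suc j → suc (toℕ y) ≡ j → Cover n a x y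

P : (n : ℕ) → Vec Sign (n ∸ 1) → Fin n → Fin n → Set
P n a = TransClosure (Cover n a)

-- Proof fields are irrelevant, so a linear extension is determined by its listing w.
record LinExt (n : ℕ) (a : Vec Sign (n ∸ 1)) : Set where
  constructor linExt
  field
    w : Vec (Fin n) n
    .injective : ∀ i j → lookup w i ≡ lookup w j → i ≡ j
    .respects  : ∀ i j → P n a (lookup w i) (lookup w j) → i <ᶠ j

-- By duality (reversing every listing) we may assume a_{i-1} = a_i = 1, so i-1 < i < i+1 in p_a,
-- while in p_{aΦ_i} the fence above i is turned upside down and i-1 < i is kept.  A linear
-- extension of p_a is a shuffle of its word on the elements below i and its word u on the
-- elements ≥ i.  Keep the positions of the letters ≥ i and replace u = α i β (i+1 lies in β)
-- by the word obtained by deleting i, reversing, and reinserting i exactly |α| letters after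
-- i+1.  Reversal flips every relation of the upper fence, i+1 now precedes i, and i only moves
-- to the right among the upper letters, so it stays after i-1: this is an injection
-- L(p_a) → L(p_{aΦ_i}).  It keeps the number of upper letters before i-1, which is at most |α|.
-- Maximality of i makes i+1 minimal in p_{aΦ_i}, so some extension starts with i+1 and has
-- upper word beginning i+1 i; a preimage of it would have |α| = 0 and yet an upper letter
-- before i-1.

module Submission where

open import Defs
open import Data.Bool using (true; false; if_then_else_)
open import Data.Empty using (⊥-elim)
open import Data.Fin using (Fin; zero; suc; toℕ; fromℕ<; punchOut) renaming (_<_ to _<ᶠ_)
open import Data.Fin.Properties
  using (toℕ-injective; toℕ-fromℕ<; toℕ<n; punchOut-injective; injective⇒≤; any?)
  renaming (_≟_ to _≟ᶠ_; _<?_ to _<ᶠ?_; suc-injective to sucᶠ-injective)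
open import Data.List using (List; []; _∷_; _++_; _∷ʳ_; length; reverse; take; drop; map; filter)
open import Data.List.Membership.Propositional using (_∈_; _∉_)
open import Data.List.Membership.Propositional.Properties
  using (∈-++⁺ˡ; ∈-++⁺ʳ; ∈-++⁻; ∈-map⁺; ∈-filter⁺; ∈-filter⁻)
open import Data.List.Properties
  using (++-assoc; length-++; length-reverse; length-map; take++drop≡id;
         reverse-++; reverse-injective; length-take; unfold-reverse; ∷-injective; ∷-injectiveˡ; ∷-injectiveʳ;
         map-injective; filter-++; filter-all; filter-none; filter-accept; filter-reject)
open import Data.List.Relation.Binary.Permutation.Propositional
  using (_↭_; ↭-refl; ↭-reflexive; ↭-sym; ↭-trans; prep; swap; ↭⇒↭ₛ; module PermutationReasoning)
open import Data.List.Relation.Binary.Permutation.Propositional.Properties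
  using (shift; ++⁺; ++⁺ˡ; ++-comm; ↭-length; ∈-resp-↭; All-resp-↭; ↭-reverse; ∷↭∷ʳ)
import Data.List.Relation.Binary.Permutation.Setoid.Properties as PermutationSetoid
open import Data.List.Relation.Unary.All using (All; []; _∷_)
import Data.List.Relation.Unary.All as All
import Data.List.Relation.Unary.All.Properties as All
open import Data.List.Relation.Unary.AllPairs using ([]; _∷_)
open import Data.List.Relation.Unary.Any using (here; there)
import Data.List.Relation.Unary.Any.Properties as Any
open import Data.List.Relation.Unary.Unique.Propositional using (Unique)
import Data.List.Relation.Unary.Unique.Propositional.Properties as Unique
open import Data.Nat using (ℕ; zero; suc; _+_; _∸_; _≤_; _<_; z≤n; s≤s; _≤?_; _≟_; _≤ᵇ_)
open import Data.Nat.Properties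
  using (0≢1+n; n≤0⇒n≡0; ≤-refl; ≤-trans; <-irrefl; <⇒≤; >⇒≢; m<n⇒m<1+n; <-≤-trans; <-trans;
         ≤-<-trans; n≤1+n; n<1+n; m≤m+n; m≤n+m; suc-injective; +-suc; +-identityʳ; +-cancelʳ-≡;
         m+[n∸m]≡n; m≤n⇒m⊓n≡m; m≤n⇒m<n∨m≡n; <-cmp; ∸-monoˡ-≤; ≤⇒≤ᵇ; ≤ᵇ⇒≤; module ≤-Reasoning)
open import Data.Product using (Σ; _×_; _,_; proj₁; proj₂)
open import Data.Sum using (inj₁; inj₂)
import Data.Vec as Vec
open import Data.Vec using (Vec; _∷_; lookup; toList; fromList)
open import Data.Vec.Membership.Propositional.Properties using (∈-lookup; ∈-toList⁺; ∈-toList⁻)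
open import Data.Vec.Properties
  using (toList∘fromList; length-toList; toList-injective; cast-is-id; lookup∘tabulate)
import Data.Vec.Relation.Unary.Any as VecAny
open import Data.Vec.Relation.Unary.Any.Properties using (lookup-index)
open import Function using (_∘_)
open import Function.Bundles using (_↔_; Inverse; Injection)
open import Function.Properties.Inverse using (Inverse⇒Injection)
open import Level using (0ℓ)
open import Relation.Binary.Construct.Closure.Transitive using ([_]; _∷_)
open import Relation.Binary.Definitions using (DecidableEquality; tri<; tri≈; tri>)
open import Relation.Binary.PropositionalEquality
  using (_≡_; _≢_; refl; sym; trans; cong; cong₂; subst; subst₂; setoid; module ≡-Reasoning)
open import Relation.Nullary using (¬_; yes; no)
open import Relation.Nullary.Decidable using (recompute)
open import Relation.Unary using (Pred; Decidable)
open import Relation.Unary.Properties using (∁?)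

private variable
  A B : Set
  x y z : A
  xs ys : List A

data Before {A : Set} (x y : A) : List A → Set where
  now   : y ∈ xs → Before x y (x ∷ xs)
  later : Before x y xs → Before x y (z ∷ xs)

Before-∈ˡ : Before x y xs → x ∈ xs
Before-∈ˡ (now _)   = here refl
Before-∈ˡ (later b) = there (Before-∈ˡ b)

Before-∈ʳ : Before x y xs → y ∈ xs
Before-∈ʳ (now y∈)  = there y∈
Before-∈ʳ (later b) = there (Before-∈ʳ b)

Before-++⁺ˡ : Before x y xs → Before x y (xs ++ ys)
Before-++⁺ˡ (now y∈)  = now (∈-++⁺ˡ y∈)
Before-++⁺ˡ (later b) = later (Before-++⁺ˡ b)

Before-++⁺ʳ : ∀ xs → Before x y ys → Before x y (xs ++ ys)
Before-++⁺ʳ []       b = b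
Before-++⁺ʳ (_ ∷ xs) b = later (Before-++⁺ʳ xs b)

Before-++-∈ : x ∈ xs → y ∈ ys → Before x y (xs ++ ys)
Before-++-∈ {xs = _ ∷ xs} (here refl) y∈ = now (∈-++⁺ʳ xs y∈)
Before-++-∈ (there x∈) y∈ = later (Before-++-∈ x∈ y∈)

Before-insert : ∀ xs → Before x y (xs ++ ys) → Before x y (xs ++ z ∷ ys)
Before-insert []       b = later b
Before-insert (_ ∷ xs) (now y∈) with ∈-++⁻ xs y∈
... | inj₁ y∈xs = now (∈-++⁺ˡ y∈xs)
... | inj₂ y∈ys = now (∈-++⁺ʳ xs (there y∈ys))
Before-insert (_ ∷ xs) (later b) = later (Before-insert xs b)

Before-delete : ∀ xs → x ≢ z → y ≢ z → Before x y (xs ++ z ∷ ys) → Before x y (xs ++ ys)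
Before-delete []       x≢z y≢z (now _)   = ⊥-elim (x≢z refl)
Before-delete []       x≢z y≢z (later b) = b
Before-delete (_ ∷ xs) x≢z y≢z (now y∈) with ∈-++⁻ xs y∈
... | inj₁ y∈xs         = now (∈-++⁺ˡ y∈xs)
... | inj₂ (here y≡z)   = ⊥-elim (y≢z y≡z)
... | inj₂ (there y∈ys) = now (∈-++⁺ʳ xs y∈ys)
Before-delete (_ ∷ xs) x≢z y≢z (later b) = later (Before-delete xs x≢z y≢z b)

Before-reverse : Before x y xs → Before y x (reverse xs)
Before-reverse {x = x} {xs = _ ∷ xs} (now y∈) rewrite unfold-reverse x xs =
  Before-++-∈ (Any.reverse⁺ y∈) (here refl)
Before-reverse {xs = z ∷ xs} (later b) rewrite unfold-reverse z xs =
  Before-++⁺ˡ (Before-reverse b)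

Before-map : (f : A → B) → Before x y xs → Before (f x) (f y) (map f xs)
Before-map f (now y∈)  = now (∈-map⁺ f y∈)
Before-map f (later b) = later (Before-map f b)

∈-map⁻-injective : (f : A → B) → (∀ {a b} → f a ≡ f b → a ≡ b) →
                   z ∈ map f xs → z ≡ f x → x ∈ xs
∈-map⁻-injective {xs = _ ∷ _} f inj (here e)   e′ = here (inj (trans (sym e′) e))
∈-map⁻-injective {xs = _ ∷ _} f inj (there z∈) e′ = there (∈-map⁻-injective f inj z∈ e′)

Before-map⁻ : ∀ {a b} (f : A → B) → (∀ {a b} → f a ≡ f b → a ≡ b) →
              Before a b (map f xs) → a ≡ f x → b ≡ f y → Before x y xs
Before-map⁻ {xs = _ ∷ _} f inj (now b∈) ea eb with inj ea
... | refl = now (∈-map⁻-injective f inj b∈ eb)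
Before-map⁻ {xs = _ ∷ _} f inj (later b) ea eb = later (Before-map⁻ f inj b ea eb)

Before-trans : Unique xs → Before x y xs → Before y z xs → Before x z xs
Before-trans (x∉ ∷ _) (now y∈)  (now _)   = ⊥-elim (All.lookup x∉ y∈ refl)
Before-trans (_ ∷ _)  (now _)   (later c) = now (Before-∈ʳ c)
Before-trans (y∉ ∷ _) (later b) (now _)   = ⊥-elim (All.lookup y∉ (Before-∈ʳ b) refl)
Before-trans (_ ∷ u)  (later b) (later c) = later (Before-trans u b c)

Before-first : ∀ xs → x ∉ xs → Before x y (xs ++ x ∷ ys) → y ∈ ys
Before-first []       _  (now y∈)  = y∈
Before-first []       _  (later b) = Before-∈ʳ b
Before-first (_ ∷ xs) x∉ (now _)   = ⊥-elim (x∉ (here refl))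
Before-first (_ ∷ xs) x∉ (later b) = Before-first xs (x∉ ∘ there) b

module _ {P : Pred A 0ℓ} (P? : Decidable P) where

  Before-filter⁺ : P x → P y → Before x y xs → Before x y (filter P? xs)
  Before-filter⁺ {x = x} Px Py (now y∈) with P? x
  ... | yes _  = now (∈-filter⁺ P? y∈ Py)
  ... | no ¬Px = ⊥-elim (¬Px Px)
  Before-filter⁺ {xs = w ∷ _} Px Py (later b) with P? w
  ... | yes _ = later (Before-filter⁺ Px Py b)
  ... | no _  = Before-filter⁺ Px Py b

  Before-filter⁻ : Before x y (filter P? xs) → Before x y xs
  Before-filter⁻ {xs = w ∷ xs} b with P? w | b
  ... | yes _ | now y∈   = now (proj₁ (∈-filter⁻ P? y∈))
  ... | yes _ | later b′ = later (Before-filter⁻ b′)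
  ... | no _  | b′       = later (Before-filter⁻ b′)

breakAt : ℕ → List ℕ → List ℕ × List ℕ
breakAt x []       = [] , []
breakAt x (w ∷ xs) with w ≟ x
... | yes _ = [] , xs
... | no _  = w ∷ proj₁ (breakAt x xs) , proj₂ (breakAt x xs)

breakAt-∈ : ∀ {x xs} → x ∈ xs →
            xs ≡ proj₁ (breakAt x xs) ++ x ∷ proj₂ (breakAt x xs) × x ∉ proj₁ (breakAt x xs)
breakAt-∈ {x} {w ∷ xs} x∈ with w ≟ x | x∈
... | yes refl | _        = refl , λ ()
... | no w≢x   | here e   = ⊥-elim (w≢x (sym e))
... | no w≢x   | there x∈′ with breakAt-∈ x∈′
...   | xs≡ , x∉ = cong (w ∷_) xs≡ , λ { (here e) → w≢x (sym e) ; (there m) → x∉ m }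

insertAt : ℕ → A → List A → List A
insertAt k z xs = take k xs ++ z ∷ drop k xs

insertAt-↭ : ∀ k (z : A) xs → insertAt k z xs ↭ z ∷ xs
insertAt-↭ k z xs = ↭-trans (shift z (take k xs) (drop k xs)) (prep z (↭-reflexive (take++drop≡id k xs)))

++-∷-cancel : ∀ xs xs′ {x : A} {ys ys′} → xs ++ x ∷ ys ≡ xs′ ++ x ∷ ys′ →
              x ∉ xs → x ∉ xs′ → xs ≡ xs′ × ys ≡ ys′
++-∷-cancel []       []        e _  _   = refl , ∷-injectiveʳ e
++-∷-cancel []       (_ ∷ _)   e _  x∉′ = ⊥-elim (x∉′ (here (∷-injectiveˡ e)))
++-∷-cancel (_ ∷ _)  []        e x∉ _   = ⊥-elim (x∉ (here (sym (∷-injectiveˡ e))))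
++-∷-cancel (w ∷ xs) (_ ∷ xs′) e x∉ x∉′ with ∷-injective e
... | refl , e′ with ++-∷-cancel xs xs′ e′ (x∉ ∘ there) (x∉′ ∘ there)
...   | refl , ys≡ = refl , ys≡

++-cancel-length : ∀ (xs xs′ : List A) {ys ys′} → length xs ≡ length xs′ → xs ++ ys ≡ xs′ ++ ys′ →
                   xs ≡ xs′ × ys ≡ ys′
++-cancel-length []       []        _ e = refl , e
++-cancel-length (_ ∷ xs) (_ ∷ xs′) l e with ∷-injective e
... | refl , e′ with ++-cancel-length xs xs′ (suc-injective l) e′
...   | refl , ys≡ = refl , ys≡

++-cancel-lengthʳ : ∀ (xs xs′ : List A) {ys ys′} → length ys ≡ length ys′ →
                    xs ++ ys ≡ xs′ ++ ys′ → xs ≡ xs′ × ys ≡ ys′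
++-cancel-lengthʳ xs xs′ {ys} {ys′} l e = ++-cancel-length xs xs′ length-xs e
  where
  length-xs : length xs ≡ length xs′
  length-xs = +-cancelʳ-≡ (length ys) (length xs) (length xs′) (begin
    length xs + length ys    ≡⟨ sym (length-++ xs) ⟩
    length (xs ++ ys)        ≡⟨ cong length e ⟩
    length (xs′ ++ ys′)      ≡⟨ length-++ xs′ ⟩
    length xs′ + length ys′  ≡⟨ cong (length xs′ +_) (sym l) ⟩
    length xs′ + length ys   ∎)
    where open ≡-Reasoning

∉-++-∷ʳ : ∀ xs {x : A} {ys} → Unique (xs ++ x ∷ ys) → x ∉ ys
∉-++-∷ʳ []       (x∉ ∷ _) x∈ = All.lookup x∉ x∈ refl
∉-++-∷ʳ (_ ∷ xs) (_ ∷ u)     = ∉-++-∷ʳ xs u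

∈-drop-++-∷ : ∀ r xs {y : A} {ys} → r ≤ length xs → y ∈ drop r (xs ++ y ∷ ys)
∈-drop-++-∷ zero    xs       _         = ∈-++⁺ʳ xs (here refl)
∈-drop-++-∷ (suc r) (_ ∷ xs) (s≤s r≤) = ∈-drop-++-∷ r xs r≤

∈-drop⁻ : ∀ r {xs} {y : A} → y ∈ drop r xs → y ∈ xs
∈-drop⁻ zero    y∈ = y∈
∈-drop⁻ (suc r) {[]} ()
∈-drop⁻ (suc r) {_ ∷ xs} y∈ = there (∈-drop⁻ r y∈)

∈-drop-++-∷⁻ : ∀ r xs {y : A} {ys} → y ∉ xs → y ∉ ys →
               y ∈ drop r (xs ++ y ∷ ys) → r ≤ length xs
∈-drop-++-∷⁻ zero    xs       _  _  _  = z≤n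
∈-drop-++-∷⁻ (suc r) []       _  y∉ y∈ = ⊥-elim (y∉ (∈-drop⁻ r y∈))
∈-drop-++-∷⁻ (suc r) (_ ∷ xs) y∉ y∉′ y∈ = s≤s (∈-drop-++-∷⁻ r xs (y∉ ∘ there) y∉′ y∈)

module Refill {P : Pred A 0ℓ} (P? : Decidable P) where

  refill : List A → List A → List A
  refill []       _  = []
  refill (x ∷ xs) ys with P? x
  refill (x ∷ xs) ys       | no _  = x ∷ refill xs ys
  refill (x ∷ xs) []       | yes _ = x ∷ refill xs []
  refill (x ∷ xs) (y ∷ ys) | yes _ = y ∷ refill xs ys

  filter-refill : ∀ xs {ys} → All P ys → length ys ≡ length (filter P? xs) → filter P? (refill xs ys) ≡ ys
  filter-refill []       {[]} _ _ = refl
  filter-refill (x ∷ xs) Pys e with P? x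
  filter-refill (x ∷ xs) Pys e | no ¬Px = trans (filter-reject P? ¬Px) (filter-refill xs Pys e)
  filter-refill (x ∷ xs) {y ∷ ys} (Py ∷ Pys) e | yes _ =
    trans (filter-accept P? Py) (cong (y ∷_) (filter-refill xs Pys (suc-injective e)))

  filter-∁-refill : ∀ xs {ys} → All P ys → filter (∁? P?) (refill xs ys) ≡ filter (∁? P?) xs
  filter-∁-refill []       _ = refl
  filter-∁-refill (x ∷ xs) Pys with P? x
  filter-∁-refill (x ∷ xs) Pys | no ¬Px =
    trans (filter-accept (∁? P?) ¬Px) (cong (x ∷_) (filter-∁-refill xs Pys))
  filter-∁-refill (x ∷ xs) {[]} Pys | yes Px =
    trans (filter-reject (∁? P?) (λ ¬Px → ¬Px Px)) (filter-∁-refill xs Pys)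
  filter-∁-refill (x ∷ xs) {y ∷ ys} (Py ∷ Pys) | yes _ =
    trans (filter-reject (∁? P?) (λ ¬Py → ¬Py Py)) (filter-∁-refill xs Pys)

  refill-reject : ∀ {x} xs {ys} → ¬ P x → refill (x ∷ xs) ys ≡ x ∷ refill xs ys
  refill-reject {x} _ ¬Px with P? x
  ... | yes Px = ⊥-elim (¬Px Px)
  ... | no _   = refl

  refill-accept : ∀ {x} xs {y ys} → P x → refill (x ∷ xs) (y ∷ ys) ≡ y ∷ refill xs ys
  refill-accept {x} _ Px with P? x
  ... | yes _  = refl
  ... | no ¬Px = ⊥-elim (¬Px Px)

  refill-refill : ∀ xs {ys zs} → All P ys →
                  length ys ≡ length (filter P? xs) → length zs ≡ length (filter P? xs) →
                  refill (refill xs ys) zs ≡ refill xs zs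
  refill-refill []       _ _ _ = refl
  refill-refill (x ∷ xs) Pys e e′ with P? x
  refill-refill (x ∷ xs) Pys e e′ | no ¬Px =
    trans (refill-reject _ ¬Px) (cong (x ∷_) (refill-refill xs Pys e e′))
  refill-refill (x ∷ xs) {y ∷ ys} {z ∷ zs} (Py ∷ Pys) e e′ | yes _ =
    trans (refill-accept _ Py) (cong (z ∷_) (refill-refill xs Pys (suc-injective e) (suc-injective e′)))

  refill-filter : ∀ xs → refill xs (filter P? xs) ≡ xs
  refill-filter []       = refl
  refill-filter (x ∷ xs) with P? x
  ... | yes _ = cong (x ∷_) (refill-filter xs)
  ... | no _  = cong (x ∷_) (refill-filter xs)

  ↭-filter-∁-++-filter : ∀ xs → xs ↭ filter (∁? P?) xs ++ filter P? xs
  ↭-filter-∁-++-filter []       = ↭-refl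
  ↭-filter-∁-++-filter (x ∷ xs) with P? x
  ... | yes _ = ↭-trans (prep x (↭-filter-∁-++-filter xs))
                        (↭-sym (shift x (filter (∁? P?) xs) (filter P? xs)))
  ... | no _  = prep x (↭-filter-∁-++-filter xs)

  refill-↭-filter-∁-++ : ∀ xs {ys} → length ys ≡ length (filter P? xs) →
                         refill xs ys ↭ filter (∁? P?) xs ++ ys
  refill-↭-filter-∁-++ []       {[]} _ = ↭-refl
  refill-↭-filter-∁-++ (x ∷ xs) e with P? x
  refill-↭-filter-∁-++ (x ∷ xs) e | no _ = prep x (refill-↭-filter-∁-++ xs e)
  refill-↭-filter-∁-++ (x ∷ xs) {y ∷ ys} e | yes _ =
    ↭-trans (prep y (refill-↭-filter-∁-++ xs (suc-injective e))) (↭-sym (shift y (filter (∁? P?) xs) ys))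

  refill-↭ : ∀ xs {ys} → ys ↭ filter P? xs → refill xs ys ↭ xs
  refill-↭ xs ys↭ = ↭-trans (refill-↭-filter-∁-++ xs (↭-length ys↭))
                      (↭-trans (++⁺ˡ (filter (∁? P?) xs) ys↭) (↭-sym (↭-filter-∁-++-filter xs)))

  module Count (_≟_ : DecidableEquality A) where

    countBefore : A → List A → ℕ
    countBefore x []       = 0
    countBefore x (w ∷ xs) with w ≟ x | P? w
    ... | yes _ | _     = 0
    ... | no _  | yes _ = suc (countBefore x xs)
    ... | no _  | no _  = countBefore x xs

    countBefore-accept : ∀ {x w} xs → w ≢ x → P w → countBefore x (w ∷ xs) ≡ suc (countBefore x xs)
    countBefore-accept {x} {w} _ w≢x Pw with w ≟ x | P? w
    ... | yes w≡x | _      = ⊥-elim (w≢x w≡x)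
    ... | no _    | yes _  = refl
    ... | no _    | no ¬Pw = ⊥-elim (¬Pw Pw)

    countBefore-refill : ∀ {x} xs {ys} → ¬ P x → All P ys → countBefore x (refill xs ys) ≡ countBefore x xs
    countBefore-refill []       _   _ = refl
    countBefore-refill {x} (w ∷ xs) ¬Px Pys with P? w
    countBefore-refill {x} (w ∷ xs) ¬Px Pys | no ¬Pw with w ≟ x | P? w
    ... | yes _    | _      = refl
    ... | no _     | yes Pw = ⊥-elim (¬Pw Pw)
    ... | no _     | no _   = countBefore-refill xs ¬Px Pys
    countBefore-refill {x} (w ∷ xs) {[]} ¬Px Pys | yes Pw with w ≟ x | P? w
    ... | yes refl | _      = ⊥-elim (¬Px Pw)
    ... | no _     | yes _  = cong suc (countBefore-refill xs ¬Px Pys)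
    ... | no _     | no ¬Pw = ⊥-elim (¬Pw Pw)
    countBefore-refill {x} (w ∷ xs) {y ∷ ys} ¬Px (Py ∷ Pys) | yes Pw with y ≟ x | P? y | w ≟ x | P? w
    ... | yes refl | _      | _        | _      = ⊥-elim (¬Px Py)
    ... | no _     | _      | yes refl | _      = ⊥-elim (¬Px Pw)
    ... | no _     | no ¬Py | no _     | _      = ⊥-elim (¬Py Py)
    ... | no _     | yes _  | no _     | no ¬Pw = ⊥-elim (¬Pw Pw)
    ... | no _     | yes _  | no _     | yes _  = cong suc (countBefore-refill xs ¬Px Pys)

    Before⇒∈-drop-countBefore : Before x y xs → ¬ P x → P y → y ∈ drop (countBefore x xs) (filter P? xs)
    Before⇒∈-drop-countBefore {x = x} (now y∈) ¬Px Py with x ≟ x | P? x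
    ... | no x≢x | _     = ⊥-elim (x≢x refl)
    ... | yes _  | yes Px = ⊥-elim (¬Px Px)
    ... | yes _  | no _  = ∈-filter⁺ P? y∈ Py
    Before⇒∈-drop-countBefore {x = x} {xs = w ∷ _} (later b) ¬Px Py with w ≟ x | P? w
    ... | yes refl | yes Px = ⊥-elim (¬Px Px)
    ... | yes refl | no _  = ∈-filter⁺ P? (Before-∈ʳ b) Py
    ... | no _     | yes _ = Before⇒∈-drop-countBefore b ¬Px Py
    ... | no _     | no _  = Before⇒∈-drop-countBefore b ¬Px Py

    ∈-drop-countBefore⇒Before : x ∈ xs → ¬ P x → y ∈ drop (countBefore x xs) (filter P? xs) →
                                Before x y xs
    ∈-drop-countBefore⇒Before {x = x} {xs = w ∷ _} x∈ ¬Px y∈ with w ≟ x | P? w | x∈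
    ... | yes refl | yes Pw | _        = ⊥-elim (¬Px Pw)
    ... | yes refl | no _   | _        = now (proj₁ (∈-filter⁻ P? y∈))
    ... | no w≢x   | _      | here e   = ⊥-elim (w≢x (sym e))
    ... | no _     | yes _  | there x∈′ = later (∈-drop-countBefore⇒Before x∈′ ¬Px y∈)
    ... | no _     | no _   | there x∈′ = later (∈-drop-countBefore⇒Before x∈′ ¬Px y∈)

Respects : Sign → ℕ → List ℕ → Set
Respects plus  c xs = Before c (suc c) xs
Respects minus c xs = Before (suc c) c xs

Respects-mono : ∀ s c → (∀ {a b} → Before a b xs → Before a b ys) → Respects s c xs → Respects s c ys
Respects-mono plus  c h = h
Respects-mono minus c h = h

Respects-reverse : ∀ s c → Respects s c xs → Respects (neg s) c (reverse xs)
Respects-reverse plus  c = Before-reverse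
Respects-reverse minus c = Before-reverse

record IsLinExt (n : ℕ) (f : ℕ → Sign) (xs : List ℕ) : Set where
  constructor isLinExt
  field
    unique   : Unique xs
    length≡  : length xs ≡ n
    bounded  : All (_< n) xs
    respects : ∀ c → suc c < n → Respects (f c) c xs

Unique-resp-↭ : xs ↭ ys → Unique xs → Unique ys
Unique-resp-↭ xs↭ys = PermutationSetoid.Unique-resp-↭ (setoid _) (↭⇒↭ₛ xs↭ys)

IsLinExt-↭ : ∀ {n f g} → ys ↭ xs → IsLinExt n f xs →
             (∀ c → suc c < n → Respects (g c) c ys) → IsLinExt n g ys
IsLinExt-↭ ys↭xs (isLinExt u l b _) =
  isLinExt (Unique-resp-↭ (↭-sym ys↭xs) u) (trans (↭-length ys↭xs) l) (All-resp-↭ (↭-sym ys↭xs) b)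

IsLinExt-reverse : ∀ {n f} → IsLinExt n f xs → IsLinExt n (neg ∘ f) (reverse xs)
IsLinExt-reverse {xs = xs} {f = f} V@(isLinExt _ _ _ r) =
  IsLinExt-↭ (↭-reverse xs) V (λ c lt → Respects-reverse (f c) c (r c lt))

IsLinExt-resp-≗ : ∀ {n f g} → (∀ c → f c ≡ g c) → IsLinExt n f xs → IsLinExt n g xs
IsLinExt-resp-≗ {xs = xs} f≗g (isLinExt u l b r) =
  isLinExt u l b (λ c lt → subst (λ s → Respects s c xs) (f≗g c) (r c lt))

interval : ℕ → ℕ → List ℕ
interval lo zero    = []
interval lo (suc k) = lo ∷ interval (suc lo) k

interval-++ : ∀ lo k l → interval lo (k + l) ≡ interval lo k ++ interval (lo + k) l
interval-++ lo zero    l rewrite +-identityʳ lo = refl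
interval-++ lo (suc k) l rewrite +-suc lo k = cong (lo ∷_) (interval-++ (suc lo) k l)

length-interval : ∀ lo k → length (interval lo k) ≡ k
length-interval lo zero    = refl
length-interval lo (suc k) = cong suc (length-interval (suc lo) k)

interval-lower : ∀ lo k → All (lo ≤_) (interval lo k)
interval-lower lo zero    = []
interval-lower lo (suc k) = ≤-refl ∷ All.map (≤-trans (n≤1+n lo)) (interval-lower (suc lo) k)

interval-upper : ∀ lo k → All (_< lo + k) (interval lo k)
interval-upper lo zero    = []
interval-upper lo (suc k) rewrite +-suc lo k = s≤s (m≤m+n lo k) ∷ interval-upper (suc lo) k

interval-unique : ∀ lo k → Unique (interval lo k)
interval-unique lo zero    = []
interval-unique lo (suc k) =
  All.map (λ lo<x lo≡x → <-irrefl lo≡x lo<x) (interval-lower (suc lo) k) ∷ interval-unique (suc lo) k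

∈-interval : ∀ lo k {c} → lo ≤ c → c < lo + k → c ∈ interval lo k
∈-interval lo zero {c} lo≤c c<lo+0 =
  ⊥-elim (<-irrefl refl (≤-<-trans lo≤c (subst (c <_) (+-identityʳ lo) c<lo+0)))
∈-interval lo (suc k) {c} lo≤c c< with m≤n⇒m<n∨m≡n lo≤c
... | inj₂ refl = here refl
... | inj₁ lo<c = there (∈-interval (suc lo) k lo<c (subst (c <_) (+-suc lo k) c<))

attach : Sign → ℕ → List ℕ → List ℕ
attach plus  x xs = x ∷ xs
attach minus x xs = xs ∷ʳ x

attach-↭ : ∀ s x xs → attach s x xs ↭ x ∷ xs
attach-↭ plus  x xs = ↭-refl
attach-↭ minus x xs = ↭-sym (∷↭∷ʳ x xs)

Before-attach : ∀ s {a b} x xs → Before a b xs → Before a b (attach s x xs)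
Before-attach plus  x xs = later
Before-attach minus x xs = Before-++⁺ˡ

fenceExt : (ℕ → Sign) → ℕ → ℕ → List ℕ
fenceExt f lo zero    = []
fenceExt f lo (suc k) = attach (f lo) lo (fenceExt f (suc lo) k)

fenceExt-↭ : ∀ f lo k → fenceExt f lo k ↭ interval lo k
fenceExt-↭ f lo zero    = ↭-refl
fenceExt-↭ f lo (suc k) = ↭-trans (attach-↭ (f lo) lo _) (prep lo (fenceExt-↭ f (suc lo) k))

∈-fenceExt : ∀ f lo k {c} → lo ≤ c → c < lo + k → c ∈ fenceExt f lo k
∈-fenceExt f lo k lo≤c c< = ∈-resp-↭ (↭-sym (fenceExt-↭ f lo k)) (∈-interval lo k lo≤c c<)

Respects-attach : ∀ s x xs → suc x ∈ xs → Respects s x (attach s x xs)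
Respects-attach plus  x xs sx∈ = now sx∈
Respects-attach minus x xs sx∈ = Before-++-∈ sx∈ (here refl)

fenceExt-respects : ∀ f lo k {c} → lo ≤ c → suc c < lo + k → Respects (f c) c (fenceExt f lo k)
fenceExt-respects f lo zero    {c} lo≤c c< =
  ⊥-elim (<-irrefl refl (≤-<-trans lo≤c (<-trans (n<1+n c) (subst (suc c <_) (+-identityʳ lo) c<))))
fenceExt-respects f lo (suc k) {c} lo≤c c< with m≤n⇒m<n∨m≡n lo≤c
... | inj₂ refl = Respects-attach (f lo) lo _ (∈-fenceExt f (suc lo) k ≤-refl (subst (suc lo <_) (+-suc lo k) c<))
... | inj₁ lo<c = Respects-mono (f c) c (Before-attach (f lo) lo _)
                    (fenceExt-respects f (suc lo) k lo<c (subst (suc c <_) (+-suc lo k) c<))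

record ProperInjection (n : ℕ) (f g : ℕ → Sign) : Set where
  field
    to           : List ℕ → List ℕ
    to-ext       : ∀ {l} → IsLinExt n f l → IsLinExt n g (to l)
    to-injective : ∀ {l₁ l₂} → IsLinExt n f l₁ → IsLinExt n f l₂ → to l₁ ≡ to l₂ → l₁ ≡ l₂
    missed       : List ℕ
    missed-ext   : IsLinExt n g missed
    to≢missed    : ∀ {l} → IsLinExt n f l → to l ≢ missed

module Reflection (n q : ℕ) (f g : ℕ → Sign)
  (q+2<n : suc (suc q) < n) (f-q : f q ≡ plus) (f-q+1 : f (suc q) ≡ plus)
  (f-q+2 : suc (suc (suc q)) < n → f (suc (suc q)) ≡ minus)
  (g-upper : ∀ c → suc c < n → suc q ≤ c → g c ≡ neg (f c))
  (g-lower : ∀ c → suc c < n → c < suc q → g c ≡ f c) where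

  -- In the numbering from 0 used here, p is the element i of the statement.
  p : ℕ
  p = suc q

  Upper : Pred ℕ 0ℓ
  Upper = p ≤_

  Upper? : Decidable Upper
  Upper? = p ≤?_

  open Refill Upper?
  open Count _≟_

  reflectWord : List ℕ → List ℕ
  reflectWord u =
    let (α , β) = breakAt p u
        (γ , δ) = breakAt (suc p) (reverse β)
    in γ ++ suc p ∷ insertAt (length α) p (δ ++ reverse α)

  reflectUpper : List ℕ → List ℕ
  reflectUpper l = refill l (reflectWord (filter Upper? l))

  module Split {u} (u-unique : Unique u) (p≺p+1 : Before p (suc p) u) where

    α β γ δ R : List ℕ
    α = proj₁ (breakAt p u)
    β = proj₂ (breakAt p u)
    γ = proj₁ (breakAt (suc p) (reverse β))
    δ = proj₂ (breakAt (suc p) (reverse β))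
    R = δ ++ reverse α

    k : ℕ
    k = length α

    u≡ : u ≡ α ++ p ∷ β
    u≡ = proj₁ (breakAt-∈ (Before-∈ˡ p≺p+1))

    p∉α : p ∉ α
    p∉α = proj₂ (breakAt-∈ (Before-∈ˡ p≺p+1))

    p∉β : p ∉ β
    p∉β = ∉-++-∷ʳ α (subst Unique u≡ u-unique)

    p+1∈β : suc p ∈ β
    p+1∈β = Before-first α p∉α (subst (Before p (suc p)) u≡ p≺p+1)

    reverse-β≡ : reverse β ≡ γ ++ suc p ∷ δ
    reverse-β≡ = proj₁ (breakAt-∈ (Any.reverse⁺ p+1∈β))

    p+1∉γ : suc p ∉ γ
    p+1∉γ = proj₂ (breakAt-∈ (Any.reverse⁺ p+1∈β))

    p∉R : p ∉ R
    p∉R p∈R with ∈-++⁻ δ p∈R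
    ... | inj₁ p∈δ = p∉β (Any.reverse⁻ (subst (p ∈_) (sym reverse-β≡) (∈-++⁺ʳ γ (there p∈δ))))
    ... | inj₂ p∈α = p∉α (Any.reverse⁻ p∈α)

    k≤length-R : k ≤ length R
    k≤length-R = subst (k ≤_) (sym (trans (length-++ δ) (cong (length δ +_) (length-reverse α))))
                       (m≤n+m k (length δ))

    length-take-k : length (take k R) ≡ k
    length-take-k = trans (length-take k R) (m≤n⇒m⊓n≡m k≤length-R)

    p∉take-k-R : p ∉ take k R
    p∉take-k-R p∈ = p∉R (subst (p ∈_) (take++drop≡id k R) (∈-++⁺ˡ p∈))

    prefix : List ℕ
    prefix = γ ++ suc p ∷ take k R

    k≤length-prefix : k ≤ length prefix
    k≤length-prefix = begin
      k                          ≡⟨ sym length-take-k ⟩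
      length (take k R)          ≤⟨ n≤1+n _ ⟩
      suc (length (take k R))    ≤⟨ m≤n+m _ (length γ) ⟩
      length γ + length (suc p ∷ take k R) ≡⟨ sym (length-++ γ) ⟩
      length prefix              ∎
      where open ≤-Reasoning

    reflectWord≡prefix++ : reflectWord u ≡ prefix ++ p ∷ drop k R
    reflectWord≡prefix++ = sym (++-assoc γ (suc p ∷ take k R) (p ∷ drop k R))

    reverse-α++β≡prefix++ : reverse (α ++ β) ≡ prefix ++ drop k R
    reverse-α++β≡prefix++ = begin
      reverse (α ++ β)                 ≡⟨ reverse-++ α β ⟩
      reverse β ++ reverse α           ≡⟨ cong (_++ reverse α) reverse-β≡ ⟩
      (γ ++ suc p ∷ δ) ++ reverse α    ≡⟨ ++-assoc γ (suc p ∷ δ) (reverse α) ⟩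
      γ ++ suc p ∷ R                   ≡⟨ cong (λ t → γ ++ suc p ∷ t) (sym (take++drop≡id k R)) ⟩
      γ ++ suc p ∷ take k R ++ drop k R ≡⟨ sym (++-assoc γ (suc p ∷ take k R) (drop k R)) ⟩
      prefix ++ drop k R               ∎
      where open ≡-Reasoning

    reflectWord-↭ : reflectWord u ↭ u
    reflectWord-↭ = begin
      γ ++ suc p ∷ insertAt k p R  ↭⟨ ++⁺ˡ γ (prep (suc p) (insertAt-↭ k p R)) ⟩
      γ ++ suc p ∷ p ∷ R           ↭⟨ ++⁺ˡ γ (swap (suc p) p ↭-refl) ⟩
      γ ++ p ∷ suc p ∷ R           ↭⟨ shift p γ (suc p ∷ R) ⟩
      p ∷ γ ++ suc p ∷ R           ≡⟨ cong (p ∷_) (sym (++-assoc γ (suc p ∷ δ) (reverse α))) ⟩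
      p ∷ (γ ++ suc p ∷ δ) ++ reverse α ≡⟨ cong (λ t → p ∷ t ++ reverse α) (sym reverse-β≡) ⟩
      p ∷ reverse β ++ reverse α   ↭⟨ prep p (++⁺ (↭-reverse β) (↭-reverse α)) ⟩
      p ∷ β ++ α                   ↭⟨ prep p (++-comm β α) ⟩
      p ∷ α ++ β                   ↭⟨ ↭-sym (shift p α β) ⟩
      α ++ p ∷ β                   ≡⟨ sym u≡ ⟩
      u                            ∎
      where open PermutationReasoning

    p+1≺p : Before (suc p) p (reflectWord u)
    p+1≺p = Before-++⁺ʳ γ (now (∈-++⁺ʳ (take k R) (here refl)))

    Before-reflectWord : ∀ {a b} → a ≢ p → b ≢ p → Before a b u → Before b a (reflectWord u)
    Before-reflectWord {a} {b} a≢p b≢p a≺b =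
      subst (Before b a) (sym reflectWord≡prefix++)
        (Before-insert prefix (subst (Before b a) reverse-α++β≡prefix++
          (Before-reverse (Before-delete α a≢p b≢p (subst (Before a b) u≡ a≺b)))))

    p∈drop-reflectWord : ∀ {r} → r ≤ k → p ∈ drop r (reflectWord u)
    p∈drop-reflectWord {r} r≤k = subst (λ t → p ∈ drop r t) (sym reflectWord≡prefix++)
                                   (∈-drop-++-∷ r prefix (≤-trans r≤k k≤length-prefix))

  reflectWord-injective : ∀ {u₁ u₂} (u₁-unique : Unique u₁) (p≺p+1₁ : Before p (suc p) u₁)
                                    (u₂-unique : Unique u₂) (p≺p+1₂ : Before p (suc p) u₂) →
                          reflectWord u₁ ≡ reflectWord u₂ → u₁ ≡ u₂
  reflectWord-injective {u₁} {u₂} u₁-unique p≺p+1₁ u₂-unique p≺p+1₂ eq = begin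
    u₁                   ≡⟨ S₁.u≡ ⟩
    S₁.α ++ p ∷ S₁.β     ≡⟨ cong₂ (λ a b → a ++ p ∷ b) α≡ β≡ ⟩
    S₂.α ++ p ∷ S₂.β     ≡⟨ S₂.u≡ ⟨
    u₂                   ∎
    where
    open ≡-Reasoning
    module S₁ = Split u₁-unique p≺p+1₁
    module S₂ = Split u₂-unique p≺p+1₂
    split-at-p+1 = ++-∷-cancel S₁.γ S₂.γ eq S₁.p+1∉γ S₂.p+1∉γ
    split-at-p = ++-∷-cancel (take S₁.k S₁.R) (take S₂.k S₂.R) (proj₂ split-at-p+1)
                             S₁.p∉take-k-R S₂.p∉take-k-R
    R≡ : S₁.R ≡ S₂.R
    R≡ = begin
      S₁.R                                 ≡⟨ take++drop≡id S₁.k S₁.R ⟨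
      take S₁.k S₁.R ++ drop S₁.k S₁.R     ≡⟨ cong₂ _++_ (proj₁ split-at-p) (proj₂ split-at-p) ⟩
      take S₂.k S₂.R ++ drop S₂.k S₂.R     ≡⟨ take++drop≡id S₂.k S₂.R ⟩
      S₂.R                                 ∎
    k≡ : S₁.k ≡ S₂.k
    k≡ = trans (sym S₁.length-take-k) (trans (cong length (proj₁ split-at-p)) S₂.length-take-k)
    split-R = ++-cancel-lengthʳ S₁.δ S₂.δ
                (trans (length-reverse S₁.α) (trans k≡ (sym (length-reverse S₂.α)))) R≡
    α≡ : S₁.α ≡ S₂.α
    α≡ = reverse-injective (proj₂ split-R)
    β≡ : S₁.β ≡ S₂.β
    β≡ = reverse-injective (begin
      reverse S₁.β                ≡⟨ S₁.reverse-β≡ ⟩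
      S₁.γ ++ suc p ∷ S₁.δ
        ≡⟨ cong₂ (λ c d → c ++ suc p ∷ d) (proj₁ split-at-p+1) (proj₁ split-R) ⟩
      S₂.γ ++ suc p ∷ S₂.δ        ≡⟨ S₂.reverse-β≡ ⟨
      reverse S₂.β                ∎)

  ¬Upper : ∀ {c} → c < p → ¬ Upper c
  ¬Upper c<p p≤c = <-irrefl refl (<-≤-trans c<p p≤c)

  ¬Upper-q : ¬ Upper q
  ¬Upper-q = ¬Upper (n<1+n q)

  module OnLinExt {l} (l-ext : IsLinExt n f l) where
    open IsLinExt l-ext

    q≺p : Before q p l
    q≺p = subst (λ s → Respects s q l) f-q (respects q (<-trans (n<1+n _) q+2<n))

    p≺p+1 : Before p (suc p) l
    p≺p+1 = subst (λ s → Respects s p l) f-q+1 (respects p q+2<n)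

    u : List ℕ
    u = filter Upper? l

    u-unique : Unique u
    u-unique = Unique.filter⁺ Upper? unique

    u-p≺p+1 : Before p (suc p) u
    u-p≺p+1 = Before-filter⁺ Upper? ≤-refl (n≤1+n p) p≺p+1

    open Split u-unique u-p≺p+1 public

    reflectWord-upper : All Upper (reflectWord u)
    reflectWord-upper = All-resp-↭ (↭-sym reflectWord-↭) (All.all-filter Upper? l)

    length-reflectWord : length (reflectWord u) ≡ length u
    length-reflectWord = ↭-length reflectWord-↭

    filter-reflectUpper : filter Upper? (reflectUpper l) ≡ reflectWord u
    filter-reflectUpper = filter-refill l reflectWord-upper length-reflectWord

    refill-reflectUpper : refill (reflectUpper l) u ≡ l
    refill-reflectUpper = trans (refill-refill l reflectWord-upper length-reflectWord refl) (refill-filter l)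

    Before-lower : ∀ {a b} → ¬ Upper a → ¬ Upper b → Before a b l → Before a b (reflectUpper l)
    Before-lower {a} {b} ¬Ua ¬Ub a≺b =
      Before-filter⁻ (∁? Upper?) (subst (Before a b) (sym (filter-∁-refill l reflectWord-upper))
        (Before-filter⁺ (∁? Upper?) ¬Ua ¬Ub a≺b))

    Before-upper : ∀ {a b} → Before a b (reflectWord u) → Before a b (reflectUpper l)
    Before-upper {a} {b} a≺b = Before-filter⁻ Upper? (subst (Before a b) (sym filter-reflectUpper) a≺b)

    countBefore-q≤k : countBefore q l ≤ k
    countBefore-q≤k = ∈-drop-++-∷⁻ (countBefore q l) α p∉α p∉β
      (subst (λ t → p ∈ drop (countBefore q l) t) u≡ (Before⇒∈-drop-countBefore q≺p ¬Upper-q ≤-refl))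

    -- p is moved to the right within the upper word, so it stays after q.
    reflected-q≺p : Before q p (reflectUpper l)
    reflected-q≺p = ∈-drop-countBefore⇒Before
      (∈-resp-↭ (↭-sym (refill-↭ l reflectWord-↭)) (Before-∈ˡ q≺p)) ¬Upper-q
      (subst₂ (λ r t → p ∈ drop r t)
              (sym (countBefore-refill l ¬Upper-q reflectWord-upper)) (sym filter-reflectUpper)
              (p∈drop-reflectWord countBefore-q≤k))

    Respects-lower : ∀ s c → suc c < p → Respects s c l → Respects s c (reflectUpper l)
    Respects-lower plus  c c+1<p = Before-lower (¬Upper (<-trans (n<1+n c) c+1<p)) (¬Upper c+1<p)
    Respects-lower minus c c+1<p = Before-lower (¬Upper c+1<p) (¬Upper (<-trans (n<1+n c) c+1<p))

    Respects-upper : ∀ s {c} → p < c → Respects s c l → Respects (neg s) c (reflectUpper l)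
    Respects-upper plus  p<c = Before-upper ∘ Before-reflectWord (>⇒≢ p<c) (>⇒≢ (m<n⇒m<1+n p<c))
                                 ∘ Before-filter⁺ Upper? (<⇒≤ p<c) (<⇒≤ (m<n⇒m<1+n p<c))
    Respects-upper minus p<c = Before-upper ∘ Before-reflectWord (>⇒≢ (m<n⇒m<1+n p<c)) (>⇒≢ p<c)
                                 ∘ Before-filter⁺ Upper? (<⇒≤ (m<n⇒m<1+n p<c)) (<⇒≤ p<c)

    respects-reflectUpper : ∀ c → suc c < n → Respects (g c) c (reflectUpper l)
    respects-reflectUpper c c+1<n with <-cmp c q
    ... | tri< c<q _ _ rewrite g-lower c c+1<n (<-trans c<q (n<1+n q)) =
          Respects-lower (f c) c (s≤s c<q) (respects c c+1<n)
    ... | tri≈ _ refl _ rewrite g-lower q c+1<n (n<1+n q) | f-q = reflected-q≺p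
    ... | tri> _ _ q<c with m≤n⇒m<n∨m≡n q<c
    ...   | inj₂ refl rewrite g-upper p c+1<n ≤-refl | f-q+1 = Before-upper p+1≺p
    ...   | inj₁ p<c rewrite g-upper c c+1<n q<c = Respects-upper (f c) p<c (respects c c+1<n)

    isLinExt-reflectUpper : IsLinExt n g (reflectUpper l)
    isLinExt-reflectUpper = IsLinExt-↭ (refill-↭ l reflectWord-↭) l-ext respects-reflectUpper

  reflectUpper-injective : ∀ {l₁ l₂} → IsLinExt n f l₁ → IsLinExt n f l₂ →
                           reflectUpper l₁ ≡ reflectUpper l₂ → l₁ ≡ l₂
  reflectUpper-injective {l₁} {l₂} l₁-ext l₂-ext eq = begin
    l₁                        ≡⟨ L₁.refill-reflectUpper ⟨
    refill (reflectUpper l₁) L₁.u ≡⟨ cong₂ refill eq u₁≡u₂ ⟩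
    refill (reflectUpper l₂) L₂.u ≡⟨ L₂.refill-reflectUpper ⟩
    l₂                        ∎
    where
    open ≡-Reasoning
    module L₁ = OnLinExt l₁-ext
    module L₂ = OnLinExt l₂-ext
    u₁≡u₂ : L₁.u ≡ L₂.u
    u₁≡u₂ = reflectWord-injective L₁.u-unique L₁.u-p≺p+1 L₂.u-unique L₂.u-p≺p+1
              (trans (sym L₁.filter-reflectUpper) (trans (cong (filter Upper?) eq) L₂.filter-reflectUpper))

  m : ℕ
  m = n ∸ suc (suc p)

  p+2+m≡n : suc (suc p) + m ≡ n
  p+2+m≡n = m+[n∸m]≡n q+2<n

  lowerExt upperExt witness : List ℕ
  lowerExt = fenceExt f 0 p
  upperExt = fenceExt g (suc (suc p)) m
  witness  = suc p ∷ lowerExt ++ p ∷ upperExt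

  witness-↭ : witness ↭ interval 0 n
  witness-↭ = begin
    suc p ∷ lowerExt ++ p ∷ upperExt     ↭⟨ shift (suc p) lowerExt (p ∷ upperExt) ⟨
    lowerExt ++ suc p ∷ p ∷ upperExt     ↭⟨ ++⁺ˡ lowerExt (swap (suc p) p ↭-refl) ⟩
    lowerExt ++ p ∷ suc p ∷ upperExt
      ↭⟨ ++⁺ (fenceExt-↭ f 0 p) (prep p (prep (suc p) (fenceExt-↭ g _ m))) ⟩
    interval 0 p ++ interval p (2 + m)   ≡⟨ interval-++ 0 p (2 + m) ⟨
    interval 0 (p + (2 + m))             ≡⟨ cong (interval 0) p+[2+m]≡n ⟩
    interval 0 n                         ∎
    where
    open PermutationReasoning
    p+[2+m]≡n : p + (2 + m) ≡ n
    p+[2+m]≡n = trans (+-suc p (suc m)) (trans (cong suc (+-suc p m)) p+2+m≡n)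

  respects-witness : ∀ c → suc c < n → Respects (g c) c witness
  respects-witness c c+1<n with <-cmp c q
  ... | tri< c<q _ _ rewrite g-lower c c+1<n (<-trans c<q (n<1+n q)) =
        Respects-mono (f c) c (later ∘ Before-++⁺ˡ) (fenceExt-respects f 0 p z≤n (s≤s c<q))
  ... | tri≈ _ refl _ rewrite g-lower q c+1<n (n<1+n q) | f-q =
        later (Before-++-∈ (∈-fenceExt f 0 p z≤n (n<1+n q)) (here refl))
  ... | tri> _ _ q<c with m≤n⇒m<n∨m≡n q<c
  ...   | inj₂ refl rewrite g-upper p c+1<n ≤-refl | f-q+1 = now (∈-++⁺ʳ lowerExt (here refl))
  ...   | inj₁ p<c with m≤n⇒m<n∨m≡n p<c
  ...     | inj₂ refl rewrite g-upper (suc p) c+1<n q<c | f-q+2 c+1<n =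
          now (∈-++⁺ʳ lowerExt (there
            (∈-fenceExt g _ m ≤-refl (subst (suc (suc p) <_) (sym p+2+m≡n) c+1<n))))
  ...     | inj₁ p+1<c =
          Respects-mono (g c) c (later ∘ Before-++⁺ʳ lowerExt ∘ later)
            (fenceExt-respects g _ m p+1<c (subst (suc c <_) (sym p+2+m≡n) c+1<n))

  isLinExt-witness : IsLinExt n g witness
  isLinExt-witness = isLinExt
    (Unique-resp-↭ (↭-sym witness-↭) (interval-unique 0 n))
    (trans (↭-length witness-↭) (length-interval 0 n))
    (All-resp-↭ (↭-sym witness-↭) (interval-upper 0 n))
    respects-witness

  filter-witness : filter Upper? witness ≡ suc p ∷ p ∷ upperExt
  filter-witness = begin
    filter Upper? (suc p ∷ lowerExt ++ p ∷ upperExt)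
      ≡⟨ filter-accept Upper? (n≤1+n p) ⟩
    suc p ∷ filter Upper? (lowerExt ++ p ∷ upperExt)
      ≡⟨ cong (suc p ∷_) (filter-++ Upper? lowerExt _) ⟩
    suc p ∷ filter Upper? lowerExt ++ filter Upper? (p ∷ upperExt)
      ≡⟨ cong₂ (λ a b → suc p ∷ a ++ b) lower upper ⟩
    suc p ∷ p ∷ upperExt
      ∎
    where
    open ≡-Reasoning
    lower : filter Upper? lowerExt ≡ []
    lower = filter-none Upper? (All.map ¬Upper (All-resp-↭ (↭-sym (fenceExt-↭ f 0 p)) (interval-upper 0 p)))
    upper : filter Upper? (p ∷ upperExt) ≡ p ∷ upperExt
    upper = filter-all Upper? (≤-refl ∷ All.map (≤-trans (≤-trans (n≤1+n p) (n≤1+n (suc p))))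
                                          (All-resp-↭ (↭-sym (fenceExt-↭ g _ m)) (interval-lower _ m)))

  -- A preimage l would have k = 0, so no upper letter precedes q in l,
  -- whereas p+1 precedes q in the witness.
  reflectUpper≢witness : ∀ {l} → IsLinExt n f l → reflectUpper l ≢ witness
  reflectUpper≢witness {l} l-ext eq = 0≢1+n (begin
    0                        ≡⟨ n≤0⇒n≡0 (subst (countBefore q l ≤_) k≡0 countBefore-q≤k) ⟨
    countBefore q l          ≡⟨ countBefore-refill l ¬Upper-q reflectWord-upper ⟨
    countBefore q (reflectUpper l) ≡⟨ cong (countBefore q) eq ⟩
    countBefore q witness    ≡⟨ countBefore-accept _ (>⇒≢ (<-trans (n<1+n q) (n<1+n p))) (n≤1+n p) ⟩
    suc _                    ∎)
    where
    open ≡-Reasoning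
    open OnLinExt l-ext
    word≡ : γ ++ suc p ∷ take k R ++ p ∷ drop k R ≡ [] ++ suc p ∷ p ∷ upperExt
    word≡ = trans (sym filter-reflectUpper) (trans (cong (filter Upper?) eq) filter-witness)
    take-k-R≡[] : take k R ≡ []
    take-k-R≡[] = proj₁ (++-∷-cancel (take k R) [] (proj₂ (++-∷-cancel γ [] word≡ p+1∉γ λ ()))
                                     p∉take-k-R λ ())
    k≡0 : k ≡ 0
    k≡0 = trans (sym length-take-k) (cong length take-k-R≡[])

  reflectUpper-properInjection : ProperInjection n f g
  reflectUpper-properInjection = record
    { to           = reflectUpper
    ; to-ext       = OnLinExt.isLinExt-reflectUpper
    ; to-injective = reflectUpper-injective
    ; missed       = witness
    ; missed-ext   = isLinExt-witness
    ; to≢missed    = reflectUpper≢witness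
    }

neg-involutive : ∀ s → neg (neg s) ≡ s
neg-involutive plus  = refl
neg-involutive minus = refl

≢⇒≡neg : ∀ {s t} → s ≢ t → s ≡ neg t
≢⇒≡neg {plus}  {plus}  s≢t = ⊥-elim (s≢t refl)
≢⇒≡neg {plus}  {minus} _   = refl
≢⇒≡neg {minus} {plus}  _   = refl
≢⇒≡neg {minus} {minus} s≢t = ⊥-elim (s≢t refl)

IsLinExt-reverse-neg : ∀ {n f l} → IsLinExt n (neg ∘ f) l → IsLinExt n f (reverse l)
IsLinExt-reverse-neg {f = f} = IsLinExt-resp-≗ (neg-involutive ∘ f) ∘ IsLinExt-reverse

ProperInjection-reverse : ∀ {n f g} → ProperInjection n (neg ∘ f) (neg ∘ g) → ProperInjection n f g
ProperInjection-reverse ι = record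
  { to           = reverse ∘ to ∘ reverse
  ; to-ext       = IsLinExt-reverse-neg ∘ to-ext ∘ IsLinExt-reverse
  ; to-injective = λ l₁-ext l₂-ext eq → reverse-injective
      (to-injective (IsLinExt-reverse l₁-ext) (IsLinExt-reverse l₂-ext) (reverse-injective eq))
  ; missed       = reverse missed
  ; missed-ext   = IsLinExt-reverse-neg missed-ext
  ; to≢missed    = λ l-ext eq → to≢missed (IsLinExt-reverse l-ext) (reverse-injective eq)
  }
  where open ProperInjection ι

properInjection : ∀ n q (f g : ℕ → Sign) → suc (suc q) < n → f q ≡ f (suc q) →
  (suc (suc (suc q)) < n → f (suc (suc q)) ≢ f (suc q)) →
  (∀ c → suc c < n → suc q ≤ c → g c ≡ neg (f c)) →
  (∀ c → suc c < n → c < suc q → g c ≡ f c) → ProperInjection n f g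
properInjection n q f g q+2<n f-q≡ f-q+2≢ g-upper g-lower = bySign (f (suc q)) refl
  where
  f-q+2≡ : ∀ {s} → f (suc q) ≡ s → suc (suc (suc q)) < n → f (suc (suc q)) ≡ neg s
  f-q+2≡ f-q+1≡s q+3<n = trans (≢⇒≡neg (f-q+2≢ q+3<n)) (cong neg f-q+1≡s)

  bySign : ∀ s → f (suc q) ≡ s → ProperInjection n f g
  bySign plus  f-q+1≡ =
    Reflection.reflectUpper-properInjection n q f g q+2<n
      (trans f-q≡ f-q+1≡) f-q+1≡ (f-q+2≡ f-q+1≡) g-upper g-lower
  bySign minus f-q+1≡ = ProperInjection-reverse
    (Reflection.reflectUpper-properInjection n q (neg ∘ f) (neg ∘ g) q+2<n
      (cong neg (trans f-q≡ f-q+1≡)) (cong neg f-q+1≡) (cong neg ∘ f-q+2≡ f-q+1≡)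
      (λ c c+1<n p≤c → cong neg (g-upper c c+1<n p≤c))
      (λ c c+1<n c<p → cong neg (g-lower c c+1<n c<p)))

injective⇒surjective : ∀ {n} (h : Fin n → Fin n) → (∀ {i j} → h i ≡ h j → i ≡ j) →
                       ∀ x → Σ (Fin n) λ i → h i ≡ x
injective⇒surjective {suc n} h h-injective x with any? (λ i → h i ≟ᶠ x)
... | yes hit = hit
... | no miss = ⊥-elim (<-irrefl refl (injective⇒≤ punchOut∘h-injective))
  where
  x≢h : ∀ i → x ≢ h i
  x≢h i x≡hi = miss (i , sym x≡hi)
  punchOut∘h-injective : ∀ {i j} → punchOut (x≢h i) ≡ punchOut (x≢h j) → i ≡ j
  punchOut∘h-injective {i} {j} = h-injective ∘ punchOut-injective (x≢h i) (x≢h j)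

Before-lookup : ∀ {m} (w : Vec A m) {i j} → i <ᶠ j → Before (lookup w i) (lookup w j) (toList w)
Before-lookup (_ ∷ w) {zero}  {suc j} _         = now (∈-toList⁺ (∈-lookup j w))
Before-lookup (_ ∷ w) {suc i} {suc j} (s≤s i<j) = later (Before-lookup w i<j)

Before-lookup⁻ : ∀ {m} (w : Vec A m) → Unique (toList w) → ∀ {i j} →
                 Before (lookup w i) (lookup w j) (toList w) → i <ᶠ j
Before-lookup⁻ (_ ∷ w) (x∉ ∷ _) {zero}  {zero}  (now x∈)  = ⊥-elim (All.lookup x∉ x∈ refl)
Before-lookup⁻ (_ ∷ w) (x∉ ∷ _) {zero}  {zero}  (later b) = ⊥-elim (All.lookup x∉ (Before-∈ˡ b) refl)
Before-lookup⁻ (_ ∷ w) _        {zero}  {suc j} _         = s≤s z≤n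
Before-lookup⁻ (_ ∷ w) (x∉ ∷ _) {suc i} {zero}  (now _)   =
  ⊥-elim (All.lookup x∉ (∈-toList⁺ (∈-lookup i w)) refl)
Before-lookup⁻ (_ ∷ w) (x∉ ∷ _) {suc i} {zero}  (later b) = ⊥-elim (All.lookup x∉ (Before-∈ʳ b) refl)
Before-lookup⁻ (_ ∷ w) (x∉ ∷ _) {suc i} {suc j} (now _)   =
  ⊥-elim (All.lookup x∉ (∈-toList⁺ (∈-lookup i w)) refl)
Before-lookup⁻ (_ ∷ w) (_ ∷ u)  {suc i} {suc j} (later b) = s≤s (Before-lookup⁻ w u b)

Unique-toList : ∀ {m} (w : Vec A m) → (∀ i j → lookup w i ≡ lookup w j → i ≡ j) → Unique (toList w)
Unique-toList Vec.[]  _         = []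
Unique-toList (x ∷ w) w-injective =
  All.tabulate x≢ ∷ Unique-toList w (λ i j → sucᶠ-injective ∘ w-injective (suc i) (suc j))
  where
  x≢ : ∀ {y} → y ∈ toList w → x ≢ y
  x≢ y∈ x≡y with w-injective zero (suc (VecAny.index (∈-toList⁻ y∈)))
                               (trans x≡y (lookup-index (∈-toList⁻ y∈)))
  ... | ()

lookup-injective : ∀ {m} (w : Vec A m) → Unique (toList w) → ∀ i j → lookup w i ≡ lookup w j → i ≡ j
lookup-injective (_ ∷ w) _        zero    zero    _  = refl
lookup-injective (_ ∷ w) (x∉ ∷ _) zero    (suc j) eq =
  ⊥-elim (All.lookup x∉ (∈-toList⁺ (∈-lookup j w)) eq)
lookup-injective (_ ∷ w) (x∉ ∷ _) (suc i) zero    eq =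
  ⊥-elim (All.lookup x∉ (∈-toList⁺ (∈-lookup i w)) (sym eq))
lookup-injective (_ ∷ w) (_ ∷ u)  (suc i) (suc j) eq = cong suc (lookup-injective w u i j eq)

toFins : ∀ {n} (l : List ℕ) → All (_< n) l → List (Fin n)
toFins []      []          = []
toFins (x ∷ l) (x<n ∷ l<n) = fromℕ< x<n ∷ toFins l l<n

map-toℕ-toFins : ∀ {n} l (l<n : All (_< n) l) → map toℕ (toFins l l<n) ≡ l
map-toℕ-toFins []      []          = refl
map-toℕ-toFins (x ∷ l) (x<n ∷ l<n) = cong₂ _∷_ (toℕ-fromℕ< x<n) (map-toℕ-toFins l l<n)

toList-subst : ∀ {m k} (eq : m ≡ k) (v : Vec A m) → toList (subst (Vec A) eq v) ≡ toList v
toList-subst refl v = refl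

≤∸1⇒< : ∀ {c n} → suc c ≤ n ∸ 1 → suc c < n
≤∸1⇒< {n = suc n} c+1≤n = s≤s c+1≤n

module Listing (n : ℕ) (a : Vec Sign (n ∸ 1)) where

  -- signs c is a_{c+1}, the orientation of the edge between the elements c and c+1 (numbered from 0).
  signs : ℕ → Sign
  signs c = a ! suc c

  listing : LinExt n a → List ℕ
  listing e = map toℕ (toList (LinExt.w e))

  listing-injective : ∀ e₁ e₂ → listing e₁ ≡ listing e₂ → e₁ ≡ e₂
  listing-injective (linExt w₁ _ _) (linExt w₂ _ _) eq
    with trans (sym (cast-is-id refl w₁)) (toList-injective refl w₁ w₂ (map-injective toℕ-injective eq))
  ... | refl = refl

  Before-of-P⇒respects : ∀ {L} → (∀ {x y} → P n a x y → Before x y L) →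
                         ∀ c → suc c < n → Respects (signs c) c (map toℕ L)
  Before-of-P⇒respects {L} P⇒Before c c+1<n = bySign (signs c) refl
    where
    c<n : c < n
    c<n = <-trans (n<1+n c) c+1<n
    c+1≤ : suc c ≤ n ∸ 1
    c+1≤ = ∸-monoˡ-≤ 1 c+1<n
    1+toℕ-c : suc (toℕ (fromℕ< c<n)) ≡ suc c
    1+toℕ-c = cong suc (toℕ-fromℕ< c<n)
    1+toℕ-c+1 : suc (toℕ (fromℕ< c+1<n)) ≡ suc (suc c)
    1+toℕ-c+1 = cong suc (toℕ-fromℕ< c+1<n)
    lift : ∀ {s t s′ t′} → toℕ s ≡ s′ → toℕ t ≡ t′ → Before s t L → Before s′ t′ (map toℕ L)
    lift refl refl = Before-map toℕ
    bySign : ∀ s → signs c ≡ s → Respects s c (map toℕ L)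
    bySign plus  eq = lift (toℕ-fromℕ< c<n) (toℕ-fromℕ< c+1<n)
                        (P⇒Before [ up (suc c) (s≤s z≤n) c+1≤ eq 1+toℕ-c 1+toℕ-c+1 ])
    bySign minus eq = lift (toℕ-fromℕ< c+1<n) (toℕ-fromℕ< c<n)
                        (P⇒Before [ down (suc c) (s≤s z≤n) c+1≤ eq 1+toℕ-c+1 1+toℕ-c ])

  isLinExt-listing : ∀ e → IsLinExt n signs (listing e)
  isLinExt-listing (linExt w w-injective w-respects) = isLinExt
    (Unique.map⁺ toℕ-injective (Unique-toList w injective))
    (trans (length-map toℕ (toList w)) (length-toList w))
    (All.map⁺ (All.tabulate λ {x} _ → toℕ<n x))
    (Before-of-P⇒respects P⇒Before)
    where
    injective : ∀ i j → lookup w i ≡ lookup w j → i ≡ j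
    injective i j eq = recompute (i ≟ᶠ j) (w-injective i j eq)
    P⇒Before : ∀ {x y} → P n a x y → Before x y (toList w)
    P⇒Before {x} {y} x<y with injective⇒surjective (lookup w) (injective _ _) x
                            | injective⇒surjective (lookup w) (injective _ _) y
    ... | i , refl | j , refl = Before-lookup w (recompute (i <ᶠ? j) (w-respects i j x<y))

  module FromListing {l} (l-ext : IsLinExt n signs l) where
    open IsLinExt l-ext

    fins : List (Fin n)
    fins = toFins l bounded

    length-fins : length fins ≡ n
    length-fins = trans (sym (length-map toℕ fins)) (trans (cong length (map-toℕ-toFins l bounded)) length≡)

    w : Vec (Fin n) n
    w = subst (Vec (Fin n)) length-fins (fromList fins)

    listing-w : map toℕ (toList w) ≡ l
    listing-w = trans (cong (map toℕ) (trans (toList-subst length-fins (fromList fins)) (toList∘fromList fins)))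
                      (map-toℕ-toFins l bounded)

    w-unique : Unique (toList w)
    w-unique = Unique.map⁻ (subst Unique (sym listing-w) unique)

    Before-w : ∀ {s t x y} → Before s t l → s ≡ toℕ x → t ≡ toℕ y → Before x y (toList w)
    Before-w {s} {t} s≺t = Before-map⁻ toℕ toℕ-injective (subst (Before s t) (sym listing-w) s≺t)

    Cover⇒Before : ∀ {x y} → Cover n a x y → Before x y (toList w)
    Cover⇒Before {x} (up _ _ x+1≤ eq refl y≡) =
      Before-w (subst (λ s → Respects s (toℕ x) l) eq (respects (toℕ x) (≤∸1⇒< x+1≤)))
               refl (suc-injective (sym y≡))
    Cover⇒Before {y = y} (down _ _ y+1≤ eq x≡ refl) =
      Before-w (subst (λ s → Respects s (toℕ y) l) eq (respects (toℕ y) (≤∸1⇒< y+1≤)))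
               (suc-injective (sym x≡)) refl

    P⇒Before : ∀ {x y} → P n a x y → Before x y (toList w)
    P⇒Before [ x⋖y ]     = Cover⇒Before x⋖y
    P⇒Before (x⋖y ∷ y<z) = Before-trans w-unique (Cover⇒Before x⋖y) (P⇒Before y<z)

    fromListing : LinExt n a
    fromListing = record
      { w         = w
      ; injective = lookup-injective w w-unique
      ; respects  = λ i j → Before-lookup⁻ w w-unique ∘ P⇒Before
      }

    listing-fromListing : listing fromListing ≡ l
    listing-fromListing = listing-w

  open FromListing public using (fromListing; listing-fromListing)

injective∧¬surjective⇒< : ∀ {k k′} → A ↔ Fin k → B ↔ Fin k′ →
                          (h : A → B) → (∀ x y → h x ≡ h y → x ≡ y) →
                          (b : B) → (∀ x → h x ≢ b) → k < k′
injective∧¬surjective⇒< {k′ = zero}   _ B↔ _ _ b _ with Inverse.to B↔ b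
... | ()
injective∧¬surjective⇒< {k′ = suc _} A↔ B↔ h h-injective b h≢b =
  s≤s (injective⇒≤ punchOut-injective′)
  where
  module A↔ = Inverse A↔
  module B↔ = Inverse B↔
  B↔-injective : ∀ {u v} → B↔.to u ≡ B↔.to v → u ≡ v
  B↔-injective = Injection.injective (Inverse⇒Injection B↔)
  b≢ : ∀ x → B↔.to b ≢ B↔.to (h (A↔.from x))
  b≢ x eq = h≢b (A↔.from x) (B↔-injective (sym eq))
  punchOut-injective′ : ∀ {x y} → punchOut (b≢ x) ≡ punchOut (b≢ y) → x ≡ y
  punchOut-injective′ {x} {y} eq = begin
    x                     ≡⟨ A↔.strictlyInverseˡ x ⟨
    A↔.to (A↔.from x)
      ≡⟨ cong A↔.to (h-injective _ _ (B↔-injective (punchOut-injective (b≢ x) (b≢ y) eq))) ⟩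
    A↔.to (A↔.from y)     ≡⟨ A↔.strictlyInverseˡ y ⟩
    y                     ∎
    where open ≡-Reasoning

ProperInjection⇒< : ∀ {n} {a b : Vec Sign (n ∸ 1)} →
                    ProperInjection n (Listing.signs n a) (Listing.signs n b) →
                    ∀ {k k′} → LinExt n a ↔ Fin k → LinExt n b ↔ Fin k′ → k < k′
ProperInjection⇒< {n} {a} {b} ι A↔ B↔ =
  injective∧¬surjective⇒< A↔ B↔ h h-injective (B.fromListing missed-ext) h≢missed
  where
  module A = Listing n a
  module B = Listing n b
  open ProperInjection ι
  h : LinExt n a → LinExt n b
  h e = B.fromListing (to-ext (A.isLinExt-listing e))
  listing-h : ∀ e → B.listing (h e) ≡ to (A.listing e)
  listing-h e = B.listing-fromListing (to-ext (A.isLinExt-listing e))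
  h-injective : ∀ e₁ e₂ → h e₁ ≡ h e₂ → e₁ ≡ e₂
  h-injective e₁ e₂ eq = A.listing-injective e₁ e₂
    (to-injective (A.isLinExt-listing e₁) (A.isLinExt-listing e₂) (trans (sym (listing-h e₁)) (trans (cong B.listing eq) (listing-h e₂))))
  h≢missed : ∀ e → h e ≢ B.fromListing missed-ext
  h≢missed e eq = to≢missed (A.isLinExt-listing e)
    (trans (sym (listing-h e)) (trans (cong B.listing eq) (B.listing-fromListing missed-ext)))

!-lookup : ∀ {m} (a : Vec Sign m) {c} (c<m : c < m) → a ! suc c ≡ lookup a (fromℕ< c<m)
!-lookup (_ ∷ a) {zero}  _         = refl
!-lookup (_ ∷ a) {suc c} (s≤s c<m) = !-lookup a c<m

Φ-! : ∀ {m} (a : Vec Sign m) i {c} → c < m →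
      Φ a i ! suc c ≡ (if i ≤ᵇ suc c then neg (a ! suc c) else a ! suc c)
Φ-! a i {c} c<m = begin
  Φ a i ! suc c                    ≡⟨ !-lookup (Φ a i) c<m ⟩
  lookup (Φ a i) (fromℕ< c<m)      ≡⟨ lookup∘tabulate _ (fromℕ< c<m) ⟩
  (if i ≤ᵇ suc (toℕ (fromℕ< c<m)) then neg (lookup a (fromℕ< c<m)) else lookup a (fromℕ< c<m))
    ≡⟨ cong₂ (λ t s → if i ≤ᵇ suc t then neg s else s) (toℕ-fromℕ< c<m) (sym (!-lookup a c<m)) ⟩
  (if i ≤ᵇ suc c then neg (a ! suc c) else a ! suc c) ∎
  where open ≡-Reasoning

Φ-!-≥ : ∀ {m} (a : Vec Sign m) {i c} → i ≤ suc c → c < m → Φ a i ! suc c ≡ neg (a ! suc c)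
Φ-!-≥ a {i} {c} i≤c+1 c<m with i ≤ᵇ suc c | ≤⇒≤ᵇ i≤c+1 | Φ-! a i c<m
... | true | _ | eq = eq

Φ-!-< : ∀ {m} (a : Vec Sign m) {i c} → suc c < i → c < m → Φ a i ! suc c ≡ a ! suc c
Φ-!-< a {i} {c} c+1<i c<m with i ≤ᵇ suc c | ≤ᵇ⇒≤ i (suc c) | Φ-! a i c<m
... | false | _      | eq = eq
... | true  | i≤c+1 | _  = ⊥-elim (<-irrefl refl (<-≤-trans c+1<i (i≤c+1 _)))

proposition3p10 : (n : ℕ) → 3 ≤ n → (a : Vec Sign (n ∸ 1)) →
    (i : ℕ) → 2 ≤ i → i ≤ n ∸ 1 → a ! i ≡ a ! (i ∸ 1) →
    (∀ j → i < j → j ≤ n ∸ 1 → a ! j ≢ a ! (j ∸ 1)) →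
    (k k′ : ℕ) → LinExt n a ↔ Fin k → LinExt n (Φ a i) ↔ Fin k′ → k < k′
proposition3p10 n _ a (suc (suc q)) (s≤s (s≤s _)) i≤n-1 a-i≡a-i-1 a-j≢a-j-1 _ _ =
  ProperInjection⇒< (properInjection n q (Listing.signs n a) (Listing.signs n (Φ a (suc (suc q))))
    (≤∸1⇒< i≤n-1)
    (sym a-i≡a-i-1)
    (λ i+1<n → a-j≢a-j-1 _ ≤-refl (∸-monoˡ-≤ 1 i+1<n))
    (λ c c+1<n q+1≤c → Φ-!-≥ a (s≤s q+1≤c) (∸-monoˡ-≤ 1 c+1<n))
    (λ c c+1<n c<q+1 → Φ-!-< a (s≤s c<q+1) (∸-monoˡ-≤ 1 c+1<n)))
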